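{- Let $T$ be a perfect binary tree with $\mathrm{diam}(T)\ge 7$. Then $\chi_i'(T)=3$.
   Context: A perfect binary tree is a tree with exactly one vertex of degree two and where every other vertex has degree one or three. $\mathrm{diam}(T)$ is the diameter. Three edges $e_1,e_2,e_3$ (in this order) are consecutive if $e_1=xy$, $e_2=yz$, $e_3=zu$ for some vertices $x,y,z,u$ (where $x=u$ is allowed). An injective edge coloring of $G$ is a map $c:E(G)\to\mathcal{C}$ such that whenever $e_1,e_2,e_3$ are consecutive edges, $c(e_1)\neq c(e_3)$. $\chi_i'(G)$ is the minimum number of colors in an injective edge coloring of $G$. -}

module Defs where

open import Data.Nat using (ℕ; zero; suc; _+_; _≤_)
open import Data.Fin using (Fin)
open import Data.Bool using (Bool; true; false; T; if_then_else_)
open import Data.List using (List; []; _∷_; _++_; [_]; map; allFin)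
open import Data.Nat.ListAction using (sum)
open import Data.List.Relation.Unary.Unique.Propositional using (Unique)
open import Data.Unit using (⊤)
open import Data.Empty using (⊥)
open import Data.Product using (_×_; ∃; ∃-syntax; Σ-syntax)
open import Data.Sum using (_⊎_)
open import Relation.Binary.PropositionalEquality using (_≡_; _≢_)
open import Relation.Nullary using (¬_)

record Graph (n : ℕ) : Set where
  field
    adj   : Fin n → Fin n → Bool
    sym   : ∀ u v → adj u v ≡ adj v u
    irref : ∀ v → adj v v ≡ false

module _ {n : ℕ} (G : Graph n) where
  open Graph G

  Adj : Fin n → Fin n → Set
  Adj u v = T (adj u v)

  degree : Fin n → ℕ
  degree v = sum (map (λ w → if adj v w then 1 else 0) (allFin n))

  data Walk : Fin n → Fin n → ℕ → Set where
    here : ∀ {v} → Walk v v 0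
    step : ∀ {u v w l} → Adj u v → Walk v w l → Walk u w (suc l)

  Connected : Set
  Connected = ∀ u v → ∃[ l ] Walk u v l

  IsWalkList : List (Fin n) → Set
  IsWalkList []            = ⊤
  IsWalkList (x ∷ [])      = ⊤
  IsWalkList (x ∷ y ∷ r)   = Adj x y × IsWalkList (y ∷ r)

  HasCycle : Set
  HasCycle = ∃[ x ] ∃[ y ] ∃[ z ] ∃[ rest ]
    (Unique (x ∷ y ∷ z ∷ rest) × IsWalkList ((x ∷ y ∷ z ∷ rest) ++ [ x ]))

  IsTree : Set
  IsTree = Connected × ¬ HasCycle

  IsPerfectBinaryTree : Set
  IsPerfectBinaryTree = IsTree ×
    (∃[ r ] (degree r ≡ 2 × (∀ w → w ≢ r → degree w ≡ 1 ⊎ degree w ≡ 3)))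

  -- diam(G) ≥ d : some pair of vertices at distance ≥ d (every walk between them has length ≥ d)
  DiamAtLeast : ℕ → Set
  DiamAtLeast d = ∃[ u ] ∃[ v ] (∀ l → Walk u v l → d ≤ l)

  -- An edge colouring with colour set Fin k: a colour for each ordered pair,
  -- required to be symmetric on edges (so it is a map on the unordered edges E(G)).
  -- Injective: for consecutive edges xy, yz, zu (x = u allowed, but e1 ≠ e2 ≠ e3,
  -- i.e. x ≠ z and y ≠ u), the colours of xy and zu differ.
  IsInjectiveEdgeColouring : (k : ℕ) → (Fin n → Fin n → Fin k) → Set
  IsInjectiveEdgeColouring k c =
    (∀ u v → Adj u v → c u v ≡ c v u) ×
    (∀ x y z u → Adj x y → Adj y z → Adj z u → x ≢ z → y ≢ u → c x y ≢ c z u)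

  HasInjectiveEdgeColouring : ℕ → Set
  HasInjectiveEdgeColouring k = ∃[ c ] IsInjectiveEdgeColouring k c

  InjChromaticIndex≡ : ℕ → Set
  InjChromaticIndex≡ m = HasInjectiveEdgeColouring m × (∀ k → HasInjectiveEdgeColouring k → m ≤ k)

module Submission where

-- Upper bound, for every tree: root it at r and colour each edge by the depth of its deeper
-- end mod 3.  Depths of adjacent vertices differ by one and no vertex has two neighbours
-- closer to r (their walks to r would close a cycle), so along consecutive edges xy, yz, zu
-- the depth profile has no peak and the colours of xy and zu come from depths 1 or 2 apart.
--
-- Lower bound: a shortest walk v₀…v₇ between vertices at distance ≥ 7 never backtracks, and
-- one of its windows v₀…v₅, v₁…v₆, v₂…v₇ has middle vertices a₃, a₄ off the root, hence of
-- degree 3 with extra neighbours w, w'.  The edges a₁a₂, a₃a₄, a₅a₆, w'a₄, wa₃ then conflict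
-- cyclically: a 5-cycle in the conflict graph, which needs three colours.

open import Defs
open import Data.Nat using (ℕ; zero; suc; _+_; _≤_; _<_; _⊔_; z≤n; s≤s)
open import Data.Nat.Properties
  using (≤-antisym; ≤-pred; <-cmp; ≤-trans; ≮⇒≥; n≮n; n≤1+n; m≤n⇒m≤1+n; <⇒≱; ≤-reflexive;
         ⊔-comm; m≤n⇒m⊔n≡n; m≥n⇒m⊔n≡m; anyUpTo?)
open import Data.Nat.Induction using (<-rec)
open import Data.Fin using (Fin) renaming (zero to fz; suc to fs)
open import Data.Fin.Properties using (any?) renaming (_≟_ to _≟F_)
open import Data.Bool using (Bool; true; false; T; if_then_else_)
open import Data.List using (List; []; _∷_; _++_; [_]; map; allFin; filter; length)
open import Data.Nat.ListAction using (sum)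
open import Data.List.Relation.Unary.All using ([]; _∷_)
open import Data.List.Relation.Unary.All.Properties using (¬Any⇒All¬)
open import Data.List.Relation.Unary.Any using (here; there)
open import Data.List.Relation.Unary.AllPairs using ([]; _∷_)
open import Data.List.Relation.Unary.Unique.Propositional using (Unique)
open import Data.List.Relation.Unary.Unique.Propositional.Properties using (allFin⁺; filter⁺)
open import Data.List.Membership.Propositional using (_∈_; _∉_)
open import Data.List.Membership.Propositional.Properties using (∈-allFin; ∈-filter⁺; ∈-filter⁻)
open import Data.List.Relation.Binary.Subset.Propositional using (_⊆_)
open import Data.Unit using (⊤; tt)
open import Data.Empty using (⊥; ⊥-elim)
open import Data.Product using (_×_; _,_; proj₁; proj₂; ∃-syntax; Σ; Σ-syntax)
open import Data.Sum using (_⊎_; inj₁; inj₂) renaming (map to map⊎)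
open import Function using (id)
open import Relation.Binary.PropositionalEquality using (_≡_; _≢_; refl; sym; trans; cong; subst; subst₂)
open import Relation.Nullary using (¬_; Dec; yes; no)
open import Relation.Nullary.Decidable using (T?; _×-dec_)
open import Relation.Binary.Definitions using (tri<; tri≈; tri>)

next : Fin 3 → Fin 3
next fz = fs fz
next (fs fz) = fs (fs fz)
next (fs (fs fz)) = fz

residue : ℕ → Fin 3
residue zero = fz
residue (suc m) = next (residue m)

Close : ℕ → ℕ → Set
Close m m' = m' ≡ suc m ⊎ m' ≡ suc (suc m)

residue-close : ∀ {m m'} → Close m m' → residue m ≢ residue m'
residue-close {m} (inj₁ refl) = differ (residue m)
  where
  differ : ∀ x → x ≢ next x
  differ fz ()
  differ (fs fz) ()
  differ (fs (fs fz)) ()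
residue-close {m} (inj₂ refl) = differ (residue m)
  where
  differ : ∀ x → x ≢ next (next x)
  differ fz ()
  differ (fs fz) ()
  differ (fs (fs fz)) ()

Step : ℕ → ℕ → Set
Step a b = b ≡ suc a ⊎ a ≡ suc b

Peak : ℕ → ℕ → ℕ → Set
Peak a b c = b ≡ suc a × b ≡ suc c

⊔-suc : ∀ m → m ⊔ suc m ≡ suc m
⊔-suc m = m≤n⇒m⊔n≡n (n≤1+n m)

suc-⊔ : ∀ m → suc m ⊔ m ≡ suc m
suc-⊔ m = m≥n⇒m⊔n≡m (n≤1+n m)

peakFree-close : ∀ {a b c e} → Step a b → Step b c → Step c e → ¬ Peak a b c → ¬ Peak b c e →
                 Close (a ⊔ b) (c ⊔ e) ⊎ Close (c ⊔ e) (a ⊔ b)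
peakFree-close {a} (inj₁ refl) (inj₁ refl) (inj₁ refl) _ _ =
  inj₁ (subst₂ Close (sym (⊔-suc a)) (sym (⊔-suc (suc (suc a)))) (inj₂ refl))
peakFree-close (inj₁ refl) (inj₁ refl) (inj₂ refl) _ noPeak = ⊥-elim (noPeak (refl , refl))
peakFree-close (inj₁ refl) (inj₂ refl) _ noPeak _ = ⊥-elim (noPeak (refl , refl))
peakFree-close {b = b} (inj₂ refl) (inj₁ refl) (inj₁ refl) _ _ =
  inj₁ (subst₂ Close (sym (suc-⊔ b)) (sym (⊔-suc (suc b))) (inj₁ refl))
peakFree-close (inj₂ refl) (inj₁ refl) (inj₂ refl) _ noPeak = ⊥-elim (noPeak (refl , refl))
peakFree-close {c = c} (inj₂ refl) (inj₂ refl) (inj₁ refl) _ _ =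
  inj₂ (subst₂ Close (sym (⊔-suc c)) (sym (suc-⊔ (suc c))) (inj₁ refl))
peakFree-close {e = e} (inj₂ refl) (inj₂ refl) (inj₂ refl) _ _ =
  inj₂ (subst₂ Close (sym (suc-⊔ e)) (sym (suc-⊔ (suc (suc e)))) (inj₂ refl))

peakFree-residues : ∀ {a b c e} → Step a b → Step b c → Step c e → ¬ Peak a b c → ¬ Peak b c e →
                    residue (a ⊔ b) ≢ residue (c ⊔ e)
peakFree-residues s₁ s₂ s₃ p₁ p₂ with peakFree-close s₁ s₂ s₃ p₁ p₂
... | inj₁ close = residue-close close
... | inj₂ close = λ eq → residue-close close (sym eq)

-- Five colours around a cycle with consecutive ones distinct force at least three colours:
-- an odd cycle is not 2-colourable.
oddCycle-needs-three : ∀ {k} (p q r s t : Fin k) → p ≢ q → q ≢ r → r ≢ s → s ≢ t → t ≢ p → 3 ≤ k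
oddCycle-needs-three {zero} () _ _ _ _ _ _ _ _ _
oddCycle-needs-three {suc zero} fz fz _ _ _ pq _ _ _ _ = ⊥-elim (pq refl)
oddCycle-needs-three {suc (suc zero)} p q r s t pq qr rs st tp =
  ⊥-elim (tp (sym (trans (alternate p q r pq qr) (alternate r s t rs st))))
  where
  alternate : ∀ (x y z : Fin 2) → x ≢ y → y ≢ z → x ≡ z
  alternate fz fz _ xy _ = ⊥-elim (xy refl)
  alternate fz (fs fz) fz _ _ = refl
  alternate fz (fs fz) (fs fz) _ yz = ⊥-elim (yz refl)
  alternate (fs fz) fz fz _ yz = ⊥-elim (yz refl)
  alternate (fs fz) fz (fs fz) _ _ = refl
  alternate (fs fz) (fs fz) _ xy _ = ⊥-elim (xy refl)
oddCycle-needs-three {suc (suc (suc k))} _ _ _ _ _ _ _ _ _ _ = s≤s (s≤s (s≤s z≤n))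

least : (P : ℕ → Set) → (∀ m → Dec (P m)) → ∀ L → P L → Σ[ l ∈ ℕ ] P l × (∀ m → P m → l ≤ m)
least P P? = <-rec _ search
  where
  search : ∀ L → (∀ {m} → m < L → P m → Σ[ l ∈ ℕ ] P l × (∀ m → P m → l ≤ m)) →
           P L → Σ[ l ∈ ℕ ] P l × (∀ m → P m → l ≤ m)
  search L below pL with anyUpTo? P? L
  ... | yes (m , m<L , pm) = below m<L pm
  ... | no none = L , pL , λ m pm → ≮⇒≥ (λ m<L → none (m , m<L , pm))

module Walks {n : ℕ} (G : Graph n) where
  open Graph G using (adj) renaming (sym to adj-sym-bool; irref to adj-irref-bool)
  open import Data.List.Membership.DecPropositional (_≟F_ {n}) using (_∈?_)

  adj-sym : ∀ {u v} → Adj G u v → Adj G v u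
  adj-sym {u} {v} = subst T (adj-sym-bool u v)

  adj-irrefl : ∀ {u v} → Adj G u v → u ≢ v
  adj-irrefl {u} a refl = subst T (adj-irref-bool u) a

  tailVertices : ∀ {a b l} → Walk G a b l → List (Fin n)
  tailVertices here = []
  tailVertices (step {v = v} _ w) = v ∷ tailVertices w

  vertices : ∀ {a b l} → Walk G a b l → List (Fin n)
  vertices {a} w = a ∷ tailVertices w

  _▹_ : ∀ {a b c l m} → Walk G a b l → Walk G b c m → Walk G a c (l + m)
  here ▹ w = w
  step x w₁ ▹ w = step x (w₁ ▹ w)

  ∈-▹ : ∀ {a b c l m v} (w₁ : Walk G a b l) (w₂ : Walk G b c m) →
        v ∈ vertices (w₁ ▹ w₂) → v ∈ vertices w₁ ⊎ v ∈ vertices w₂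
  ∈-▹ here w₂ v∈ = inj₂ v∈
  ∈-▹ (step x w₁) w₂ (here e) = inj₁ (here e)
  ∈-▹ (step x w₁) w₂ (there v∈) = map⊎ there id (∈-▹ w₁ w₂ v∈)

  reverse : ∀ {a b l} → Walk G a b l → Σ ℕ (Walk G b a)
  reverse here = 0 , here
  reverse (step x w) = _ , (proj₂ (reverse w) ▹ step (adj-sym x) here)

  ∈-reverse : ∀ {a b l v} (w : Walk G a b l) → v ∈ vertices (proj₂ (reverse w)) → v ∈ vertices w
  ∈-reverse here v∈ = v∈
  ∈-reverse (step x w) v∈ with ∈-▹ (proj₂ (reverse w)) (step (adj-sym x) here) v∈
  ... | inj₁ v∈rev = there (∈-reverse w v∈rev)
  ... | inj₂ (here e) = there (here e)
  ... | inj₂ (there (here e)) = here e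

  record Path (a b : Fin n) : Set where
    field
      {len}  : ℕ
      walk   : Walk G a b len
      simple : Unique (vertices walk)
  open Path

  suffix : ∀ {u v b l} (w : Walk G v b l) → Unique (vertices w) → u ∈ vertices w →
           Σ[ p ∈ Path u b ] vertices (walk p) ⊆ vertices w
  suffix w U (here refl) = record { walk = w ; simple = U } , id
  suffix (step x w) (_ ∷ U) (there u∈) with suffix w U u∈
  ... | p , sub = p , λ v∈ → there (sub v∈)

  shorten : ∀ {a b l} (w : Walk G a b l) → Σ[ p ∈ Path a b ] vertices (walk p) ⊆ vertices w
  shorten here = record { walk = here ; simple = [] ∷ [] } , id
  shorten {a} (step x w) with shorten w
  ... | p , sub with a ∈? vertices (walk p)
  ...   | yes a∈ = let q , sub' = suffix (walk p) (simple p) a∈ in q , λ v∈ → there (sub (sub' v∈))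
  ...   | no a∉ = record { walk = step x (walk p) ; simple = ¬Any⇒All¬ _ a∉ ∷ simple p } , extend
    where
    extend : vertices (step x (walk p)) ⊆ vertices (step x w)
    extend (here e) = here e
    extend (there v∈) = there (sub v∈)

  closing-walk : ∀ {y z b l} (w : Walk G z b l) → Adj G b y → IsWalkList G (vertices w ++ [ y ])
  closing-walk here by = by , tt
  closing-walk (step x w) by = x , closing-walk w by

  cycle-around : ∀ {y a b l} → Adj G y a → Adj G y b → a ≢ b → (w : Walk G a b l) →
                 y ∉ vertices w → HasCycle G
  cycle-around {y} {a} {b} ya yb a≢b w y∉ with shorten w
  ... | p , sub = close (walk p) (simple p) (λ y∈ → y∉ (sub y∈))
    where
    close : ∀ {l} (path : Walk G a b l) → Unique (vertices path) → y ∉ vertices path → HasCycle G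
    close here _ _ = ⊥-elim (a≢b refl)
    close (step {v = z} x w') U y∉w =
      y , a , z , tailVertices w' , (¬Any⇒All¬ _ y∉w ∷ U) , ya , x , closing-walk w' (adj-sym yb)

  walk? : ∀ l u v → Dec (Walk G u v l)
  walk? zero u v with u ≟F v
  ... | yes refl = yes here
  ... | no u≢v = no λ { here → u≢v refl }
  walk? (suc l) u v with any? (λ w → T? (adj u w) ×-dec walk? l w v)
  ... | yes (w , a , p) = yes (step a p)
  ... | no none = no λ { (step a p) → none (_ , a , p) }

  Geodesic : ∀ {a b l} → Walk G a b l → Set
  Geodesic {a} {b} {l} _ = ∀ m → Walk G a b m → l ≤ m

  shortest : Connected G → ∀ u v → Σ[ l ∈ ℕ ] Σ[ w ∈ Walk G u v l ] Geodesic w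
  shortest conn u v = least (Walk G u v) (λ l → walk? l u v) (proj₁ (conn u v)) (proj₂ (conn u v))

  geodesic-tail : ∀ {a b c l} (x : Adj G a b) (w : Walk G b c l) → Geodesic (step x w) → Geodesic w
  geodesic-tail x w g m w' = ≤-pred (g (suc m) (step x w'))

  NonBacktracking : ∀ {a b l} → Walk G a b l → Set
  NonBacktracking here = ⊤
  NonBacktracking (step _ here) = ⊤
  NonBacktracking (step {u = a} _ w@(step {v = c} _ _)) = a ≢ c × NonBacktracking w

  geodesic-nonBacktracking : ∀ {a b l} (w : Walk G a b l) → Geodesic w → NonBacktracking w
  geodesic-nonBacktracking here _ = tt
  geodesic-nonBacktracking (step _ here) _ = tt
  geodesic-nonBacktracking (step {u = a} x w@(step {v = c} y w')) g =
    returns , geodesic-nonBacktracking w (geodesic-tail x w g)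
    where
    returns : a ≢ c
    returns refl = n≮n _ (≤-trans (n≤1+n _) (g _ w'))

module Depth {n : ℕ} (G : Graph n) (conn : Connected G) (acyclic : ¬ HasCycle G) (r : Fin n) where
  open Walks G

  depth : Fin n → ℕ
  depth v = proj₁ (shortest conn v r)

  depthWalk : ∀ v → Walk G v r (depth v)
  depthWalk v = proj₁ (proj₂ (shortest conn v r))

  depth-minimal : ∀ v l → Walk G v r l → depth v ≤ l
  depth-minimal v = proj₂ (proj₂ (shortest conn v r))

  depth-on-walk : ∀ {u v l} (w : Walk G u r l) → v ∈ vertices w → depth v ≤ l
  depth-on-walk {u} {l = l} w (here refl) = depth-minimal u l w
  depth-on-walk (step x w) (there v∈) = m≤n⇒m≤1+n (depth-on-walk w v∈)

  avoids : ∀ {u y l} (w : Walk G u r l) → y ≢ u → l ≤ depth y → y ∉ vertices w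
  avoids w y≢u l≤d (here refl) = y≢u refl
  avoids (step x w) y≢u l≤d (there y∈) = <⇒≱ (s≤s (depth-on-walk w y∈)) l≤d

  -- No vertex has two distinct neighbours that are not deeper than itself: their walks
  -- to r would join them while avoiding the vertex, closing a cycle.
  no-two-lower-neighbours : ∀ {y x z} → Adj G y x → Adj G y z → x ≢ z →
                            depth x ≤ depth y → depth z ≤ depth y → ⊥
  no-two-lower-neighbours {y} {x} {z} yx yz x≢z dx dz =
    acyclic (cycle-around yx yz x≢z (depthWalk x ▹ back) y∉)
    where
    back : Walk G r z (proj₁ (reverse (depthWalk z)))
    back = proj₂ (reverse (depthWalk z))
    y∉ : y ∉ vertices (depthWalk x ▹ back)
    y∉ y∈ with ∈-▹ (depthWalk x) back y∈
    ... | inj₁ y∈x = avoids (depthWalk x) (adj-irrefl yx) dx y∈x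
    ... | inj₂ y∈z = avoids (depthWalk z) (adj-irrefl yz) dz (∈-reverse (depthWalk z) y∈z)

  depth-step : ∀ {u v} → Adj G u v → depth u ≤ suc (depth v)
  depth-step {u} {v} uv = depth-minimal u _ (step uv (depthWalk v))

  -- Adjacent vertices never have equal depth: the deeper one of an equal pair would have
  -- its neighbour and its successor on the walk to r as two lower neighbours.
  adjacent-depths-differ : ∀ {u v} → Adj G u v → depth u ≢ depth v
  adjacent-depths-differ {u} {v} uv du≡dv = split (depthWalk u) refl
    where
    split : ∀ {l} → Walk G u r l → depth u ≡ l → ⊥
    split here du = adj-irrefl uv (sym (root (subst (Walk G v r) dv≡0 (depthWalk v))))
      where
      dv≡0 : depth v ≡ 0
      dv≡0 = trans (sym du≡dv) du
      root : ∀ {v} → Walk G v r 0 → v ≡ r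
      root here = refl
    split (step {v = p} up wp) du = no-two-lower-neighbours up uv p≢v dp (≤-reflexive (sym du≡dv))
      where
      dp : depth p ≤ depth u
      dp = subst (depth p ≤_) (sym du) (m≤n⇒m≤1+n (depth-minimal p _ wp))
      p≢v : p ≢ v
      p≢v refl = n≮n _ (subst (_≤ _) (trans (sym du≡dv) du) (depth-minimal p _ wp))

  adjacent-depths : ∀ {u v} → Adj G u v → Step (depth u) (depth v)
  adjacent-depths {u} {v} uv with <-cmp (depth u) (depth v)
  ... | tri< du<dv _ _ = inj₁ (≤-antisym (depth-step (adj-sym uv)) du<dv)
  ... | tri≈ _ du≡dv _ = ⊥-elim (adjacent-depths-differ uv du≡dv)
  ... | tri> _ _ du>dv = inj₂ (≤-antisym (depth-step uv) du>dv)

  no-peak : ∀ {x y z} → Adj G x y → Adj G y z → x ≢ z → ¬ Peak (depth x) (depth y) (depth z)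
  no-peak xy yz x≢z (dy≡dx+1 , dy≡dz+1) =
    no-two-lower-neighbours (adj-sym xy) yz x≢z (lower dy≡dx+1) (lower dy≡dz+1)
    where
    lower : ∀ {a b} → b ≡ suc a → a ≤ b
    lower refl = n≤1+n _

tree-colouring : ∀ {n} (G : Graph n) → Connected G → ¬ HasCycle G → Fin n →
                 HasInjectiveEdgeColouring G 3
tree-colouring {n} G conn acyclic r = colour , symmetric , injective
  where
  open Depth G conn acyclic r
  colour : Fin n → Fin n → Fin 3
  colour u v = residue (depth u ⊔ depth v)
  symmetric : ∀ u v → Adj G u v → colour u v ≡ colour v u
  symmetric u v _ = cong residue (⊔-comm (depth u) (depth v))
  injective : ∀ x y z u → Adj G x y → Adj G y z → Adj G z u → x ≢ z → y ≢ u → colour x y ≢ colour z u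
  injective x y z u xy yz zu x≢z y≢u =
    peakFree-residues (adjacent-depths xy) (adjacent-depths yz) (adjacent-depths zu)
      (no-peak xy yz x≢z) (no-peak yz zu y≢u)

sum-indicator : ∀ {A : Set} (p : A → Bool) (xs : List A) →
                sum (map (λ x → if p x then 1 else 0) xs) ≡ length (filter (λ x → T? (p x)) xs)
sum-indicator p [] = refl
sum-indicator p (x ∷ xs) with p x
... | true = cong suc (sum-indicator p xs)
... | false = sum-indicator p xs

two-members : ∀ {A : Set} {a b : A} {xs : List A} → a ∈ xs → b ∈ xs → a ≢ b → 2 ≤ length xs
two-members (here refl) (here refl) a≢b = ⊥-elim (a≢b refl)
two-members (here _) (there (here _)) _ = s≤s (s≤s z≤n)
two-members (here _) (there (there _)) _ = s≤s (s≤s z≤n)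
two-members (there (here _)) (here _) _ = s≤s (s≤s z≤n)
two-members (there (there _)) (here _) _ = s≤s (s≤s z≤n)
two-members (there a∈) (there b∈) a≢b = m≤n⇒m≤1+n (two-members a∈ b∈ a≢b)

pigeonhole : ∀ {A : Set} {a b x y z : A} → x ≡ a ⊎ x ≡ b → y ≡ a ⊎ y ≡ b → z ≡ a ⊎ z ≡ b →
             x ≡ y ⊎ x ≡ z ⊎ y ≡ z
pigeonhole (inj₁ refl) (inj₁ refl) _ = inj₁ refl
pigeonhole (inj₂ refl) (inj₂ refl) _ = inj₁ refl
pigeonhole (inj₁ refl) (inj₂ refl) (inj₁ refl) = inj₂ (inj₁ refl)
pigeonhole (inj₁ refl) (inj₂ refl) (inj₂ refl) = inj₂ (inj₂ refl)
pigeonhole (inj₂ refl) (inj₁ refl) (inj₁ refl) = inj₂ (inj₂ refl)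
pigeonhole (inj₂ refl) (inj₁ refl) (inj₂ refl) = inj₂ (inj₁ refl)

third-member : ∀ {m} (xs : List (Fin m)) → Unique xs → length xs ≡ 3 → ∀ a b →
               ∃[ c ] c ∈ xs × c ≢ a × c ≢ b
third-member (c₁ ∷ c₂ ∷ c₃ ∷ []) ((c₁≢c₂ ∷ c₁≢c₃ ∷ []) ∷ (c₂≢c₃ ∷ []) ∷ [] ∷ []) refl a b
  with inPair c₁ | inPair c₂ | inPair c₃
  where
  inPair : ∀ c → (c ≡ a ⊎ c ≡ b) ⊎ (c ≢ a × c ≢ b)
  inPair c with c ≟F a | c ≟F b
  ... | yes c≡a | _ = inj₁ (inj₁ c≡a)
  ... | no _ | yes c≡b = inj₁ (inj₂ c≡b)
  ... | no c≢a | no c≢b = inj₂ (c≢a , c≢b)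
... | inj₂ outside | _ | _ = c₁ , here refl , outside
... | inj₁ _ | inj₂ outside | _ = c₂ , there (here refl) , outside
... | inj₁ _ | inj₁ _ | inj₂ outside = c₃ , there (there (here refl)) , outside
... | inj₁ e₁ | inj₁ e₂ | inj₁ e₃ with pigeonhole e₁ e₂ e₃
...   | inj₁ c₁≡c₂ = ⊥-elim (c₁≢c₂ c₁≡c₂)
...   | inj₂ (inj₁ c₁≡c₃) = ⊥-elim (c₁≢c₃ c₁≡c₃)
...   | inj₂ (inj₂ c₂≡c₃) = ⊥-elim (c₂≢c₃ c₂≡c₃)

module Degrees {n : ℕ} (G : Graph n) where
  open Graph G using (adj)

  neighbours : Fin n → List (Fin n)
  neighbours v = filter (λ w → T? (adj v w)) (allFin n)

  degree≡neighbours : ∀ v → degree G v ≡ length (neighbours v)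
  degree≡neighbours v = sum-indicator (adj v) (allFin n)

  neighbour-∈ : ∀ {v w} → Adj G v w → w ∈ neighbours v
  neighbour-∈ {v} {w} vw = ∈-filter⁺ (λ w → T? (adj v w)) (∈-allFin w) vw

  two-neighbours : ∀ {v a b} → Adj G v a → Adj G v b → a ≢ b → 2 ≤ degree G v
  two-neighbours {v} va vb a≢b =
    subst (2 ≤_) (sym (degree≡neighbours v)) (two-members (neighbour-∈ va) (neighbour-∈ vb) a≢b)

  third-neighbour : ∀ {v} → degree G v ≡ 3 → ∀ a b → ∃[ c ] Adj G v c × c ≢ a × c ≢ b
  third-neighbour {v} deg3 a b
    with third-member (neighbours v) (filter⁺ (λ w → T? (adj v w)) {allFin n} (allFin⁺ n))
                      (trans (sym (degree≡neighbours v)) deg3) a b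
  ... | c , c∈ , c≢a , c≢b =
    c , proj₂ (∈-filter⁻ (λ w → T? (adj v w)) {xs = allFin n} c∈) , c≢a , c≢b

Branching : ∀ {n} → Graph n → Fin n → Set
Branching G R = ∀ {v a b} → v ≢ R → Adj G v a → Adj G v b → a ≢ b → ∃[ c ] Adj G v c × c ≢ a × c ≢ b

perfect-branching : ∀ {n} (G : Graph n) (R : Fin n) →
                    (∀ w → w ≢ R → degree G w ≡ 1 ⊎ degree G w ≡ 3) → Branching G R
perfect-branching G R degrees {v} {a} {b} v≢R va vb a≢b with degrees v v≢R
... | inj₂ deg3 = Degrees.third-neighbour G deg3 a b
... | inj₁ deg1 = ⊥-elim (n≮n 1 (subst (2 ≤_) deg1 (Degrees.two-neighbours G va vb a≢b)))

module LowerBound {n k : ℕ} (G : Graph n) (c : Fin n → Fin n → Fin k)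
                  (ok : IsInjectiveEdgeColouring G k c) where
  open Walks G using (adj-sym; adj-irrefl; NonBacktracking)

  symmetric : ∀ u v → Adj G u v → c u v ≡ c v u
  symmetric = proj₁ ok

  conflict : ∀ x y z u → Adj G x y → Adj G y z → Adj G z u → x ≢ z → y ≢ u → c x y ≢ c z u
  conflict = proj₂ ok

  five-edge-conflict : ∀ {a₁ a₂ a₃ a₄ a₅ a₆ w w'} →
    Adj G a₁ a₂ → Adj G a₂ a₃ → Adj G a₃ a₄ → Adj G a₄ a₅ → Adj G a₅ a₆ →
    a₁ ≢ a₃ → a₂ ≢ a₄ → a₃ ≢ a₅ → a₄ ≢ a₆ →
    Adj G a₃ w → w ≢ a₂ → w ≢ a₄ → Adj G a₄ w' → w' ≢ a₃ → w' ≢ a₅ → 3 ≤ k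
  five-edge-conflict {a₁} {a₂} {a₃} {a₄} {a₅} {a₆} {w} {w'}
                     x₁₂ x₂₃ x₃₄ x₄₅ x₅₆ n₁₃ n₂₄ n₃₅ n₄₆ x₃w w≢a₂ w≢a₄ x₄w' w'≢a₃ w'≢a₅ =
    oddCycle-needs-three (c a₁ a₂) (c a₃ a₄) (c a₅ a₆) (c w' a₄) (c w a₃)
      (conflict a₁ a₂ a₃ a₄ x₁₂ x₂₃ x₃₄ n₁₃ n₂₄)
      (conflict a₃ a₄ a₅ a₆ x₃₄ x₄₅ x₅₆ n₃₅ n₄₆)
      (λ e → conflict w' a₄ a₅ a₆ (adj-sym x₄w') x₄₅ x₅₆ w'≢a₅ n₄₆ (sym e))
      (λ e → conflict w a₃ a₄ w' (adj-sym x₃w) x₃₄ x₄w' w≢a₄ (λ q → w'≢a₃ (sym q))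
               (trans (sym e) (symmetric w' a₄ (adj-sym x₄w'))))
      (λ e → conflict w a₃ a₂ a₁ (adj-sym x₃w) (adj-sym x₂₃) (adj-sym x₁₂) w≢a₂ (λ q → n₁₃ (sym q))
               (trans e (symmetric a₁ a₂ x₁₂)))

  module _ {R : Fin n} (branching : Branching G R) where

    window : ∀ {a₁ a₂ a₃ a₄ a₅ a₆} →
      Adj G a₁ a₂ → Adj G a₂ a₃ → Adj G a₃ a₄ → Adj G a₄ a₅ → Adj G a₅ a₆ →
      a₁ ≢ a₃ → a₂ ≢ a₄ → a₃ ≢ a₅ → a₄ ≢ a₆ → a₃ ≢ R → a₄ ≢ R → 3 ≤ k
    window x₁₂ x₂₃ x₃₄ x₄₅ x₅₆ n₁₃ n₂₄ n₃₅ n₄₆ a₃≢R a₄≢R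
      with branching a₃≢R (adj-sym x₂₃) x₃₄ n₂₄ | branching a₄≢R (adj-sym x₃₄) x₄₅ n₃₅
    ... | w , x₃w , w≢a₂ , w≢a₄ | w' , x₄w' , w'≢a₃ , w'≢a₅ =
      five-edge-conflict x₁₂ x₂₃ x₃₄ x₄₅ x₅₆ n₁₃ n₂₄ n₃₅ n₄₆ x₃w w≢a₂ w≢a₄ x₄w' w'≢a₃ w'≢a₅

    -- A non-backtracking walk v₀…v₇ contains such a window: v₂…v₇ if v₃ is the root,
    -- v₀…v₅ if v₄ is the root, and v₁…v₆ otherwise.
    long-walk-needs-three : ∀ {a b l} (w : Walk G a b l) → 7 ≤ l → NonBacktracking w → 3 ≤ k
    long-walk-needs-three
      (step x₀₁ (step {v = v₂} x₁₂ (step {v = v₃} x₂₃ (step {v = v₄} x₃₄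
        (step {v = v₅} x₄₅ (step x₅₆ (step x₆₇ _)))))))
      (s≤s (s≤s (s≤s (s≤s (s≤s (s≤s (s≤s _)))))))
      (n₀₂ , n₁₃ , n₂₄ , n₃₅ , n₄₆ , n₅₇ , _)
      with v₃ ≟F R | v₄ ≟F R
    ... | yes refl | _ =
      window x₂₃ x₃₄ x₄₅ x₅₆ x₆₇ n₂₄ n₃₅ n₄₆ n₅₇ (λ e → adj-irrefl x₃₄ (sym e)) (λ e → n₃₅ (sym e))
    ... | no _ | yes refl =
      window x₀₁ x₁₂ x₂₃ x₃₄ x₄₅ n₀₂ n₁₃ n₂₄ n₃₅ n₂₄ (adj-irrefl x₃₄)
    ... | no v₃≢R | no v₄≢R =
      window x₁₂ x₂₃ x₃₄ x₄₅ x₅₆ n₁₃ n₂₄ n₃₅ n₄₆ v₃≢R v₄≢R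

corollary3 : (n : ℕ) (T : Graph n) → IsPerfectBinaryTree T → DiamAtLeast T 7 →
    InjChromaticIndex≡ T 3
corollary3 n T ((conn , acyclic) , (R , _ , degrees)) (u , t , far) =
  tree-colouring T conn acyclic R , needsThree
  where
  open Walks T using (shortest; geodesic-nonBacktracking)
  needsThree : ∀ k → HasInjectiveEdgeColouring T k → 3 ≤ k
  needsThree k (c , ok) with shortest conn u t
  ... | l , geodesic , minimal =
    LowerBound.long-walk-needs-three T c ok (perfect-branching T R degrees)
      geodesic (far l geodesic) (geodesic-nonBacktracking geodesic minimal)
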